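{- In the partizan restricted chocolate bar game described below, with the sets defined below: (i) if Left is to move from a position $(x,y,s)\in\mathcal{N}$, then she can move to a position $(v,w,t)\in\mathcal{P}\cup\mathcal{L}$; (ii) if Right is to move from a position $(x,y,s)\in\mathcal{N}$, then he can move to a position $(v,w,t)\in\mathcal{P}\cup\mathcal{R}$.
   Context: A black-and-white chocolate bar $(x,y,s)$ with $x,y\in\mathbb{N}$, $s\in\{0,1\}$, is an $x\times y$ matrix (height $x$, width $y$) with entries in $\{0,1\}$ (1 = black, 0 = white) in a checkerboard pattern whose top-left entry is $s$: entry $(i,j)$ is $s$ if $i+j$ is even and $1-s$ otherwise. Partizan restricted chocolate bar game: players Left and Right alternate. On a move, the player cuts the bar along one horizontal or vertical grid line into two nonempty rectangular pieces and eats one of them; the other piece is the new position. Left may eat a piece only if it contains no more black (1) blocks than the other piece (if equal she may eat either); Right may eat a piece only if it contains no more white (0) blocks than the other (if equal, either). In addition, Left may eat the single white block $(1,1,0)$ and Right may eat the single black block $(1,1,1)$, leaving the empty bar, denoted $(0,0)$. A player who cannot move loses. Sets: $\mathcal{P}_a=\{(2^n(2p+5)-1,2^m(2p+5)-1,s): n,m,p\in\mathbb{Z}_{\ge0}, s\in\{0,1\}\}$, $\mathcal{P}_b=\{(2^n3-1,2^m4-1,s): n,m\in\mathbb{Z}_{\ge0}, s\in\{0,1\}\}$, $\mathcal{P}_c=\{(2^n4-1,2^m3-1,s): n,m\in\mathbb{Z}_{\ge0}, s\in\{0,1\}\}$, $\mathcal{P}=\mathcal{P}_a\cup\mathcal{P}_b\cup\mathcal{P}_c\cup\{(1,2,s),(2,1,s):s\in\{0,1\}\}\cup\{(0,0)\}$.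 $\mathcal{L}=\{(2n+5,1,0),(1,2n+5,0):n\in\mathbb{Z}_{\ge0}\}\cup\{(1,1,0)\}$. $\mathcal{R}=\{(2n+5,1,1),(1,2n+5,1):n\in\mathbb{Z}_{\ge0}\}\cup\{(1,1,1)\}$. $\mathcal{N}=\{(x,y,s):x,y\in\mathbb{N}, s\in\{0,1\}\}\setminus(\mathcal{P}\cup\mathcal{L}\cup\mathcal{R})$. -}

module Defs where

open import Data.Nat using (ℕ; zero; suc; _+_; _*_; _∸_; _^_; _≤_; _<_)
open import Data.Nat.Base using (_%_)
open import Data.Bool using (Bool; true; false; not; if_then_else_; _≟_)
open import Data.List using (List; upTo; map; sum; concatMap; filter; length)
open import Data.Product using (Σ; ∃; ∃-syntax; _×_; _,_)
open import Data.Sum using (_⊎_)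
open import Relation.Nullary using (¬_)
open import Data.Empty using (⊥)
open import Relation.Binary.PropositionalEquality using (_≡_)

-- Colours: true = 1 = black, false = 0 = white.
Colour : Set
Colour = Bool

data Pos : Set where
  empty : Pos
  bar   : ℕ → ℕ → Colour → Pos

-- Entry (i , j) (0-indexed; parity of i+j is the same as 1-indexed)
-- of the checkerboard matrix with top-left entry s.
entry : Colour → ℕ → ℕ → Colour
entry s i j = if ((i + j) % 2 Data.Nat.≡ᵇ 0) then s else not s

range : ℕ → ℕ → List ℕ
range a b = map (a +_) (upTo (b ∸ a))

-- Number of blocks of colour c in rows [r0,r1), columns [c0,c1)
-- of the checkerboard matrix with top-left s.
count : Colour → Colour → ℕ → ℕ → ℕ → ℕ → ℕ
count c s r0 r1 c0 c1 =
  length (filter (λ ij → entry s (Data.Product.proj₁ ij) (Data.Product.proj₂ ij) ≟ c)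
    (concatMap (λ i → map (λ j → i , j) (range c0 c1)) (range r0 r1)))

data Player : Set where
  Left Right : Player

-- The colour a player may not eat more of: Left counts black, Right counts white.
restricted : Player → Colour
restricted Left  = true
restricted Right = false

-- Pieces are sub-rectangles of the original bar; the kept piece becomes
-- a new bar whose top-left colour is the original entry at its corner.
data Move (pl : Player) : Pos → Pos → Set where
  hEatTop : ∀ {x y s k} → 1 ≤ k → k < x →
    count (restricted pl) s 0 k 0 y ≤ count (restricted pl) s k x 0 y →
    Move pl (bar x y s) (bar (x ∸ k) y (entry s k 0))
  hEatBottom : ∀ {x y s k} → 1 ≤ k → k < x →
    count (restricted pl) s k x 0 y ≤ count (restricted pl) s 0 k 0 y →
    Move pl (bar x y s) (bar k y s)
  vEatLeft : ∀ {x y s k} → 1 ≤ k → k < y →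
    count (restricted pl) s 0 x 0 k ≤ count (restricted pl) s 0 x k y →
    Move pl (bar x y s) (bar x (y ∸ k) (entry s 0 k))
  vEatRight : ∀ {x y s k} → 1 ≤ k → k < y →
    count (restricted pl) s 0 x k y ≤ count (restricted pl) s 0 x 0 k →
    Move pl (bar x y s) (bar x k s)
  -- Left eats the single white block (1,1,0); Right the single black (1,1,1)
  eatSingle : Move pl (bar 1 1 (not (restricted pl))) empty

InPa : Pos → Set
InPa empty = ⊥
InPa (bar x y s) = ∃[ n ] ∃[ m ] ∃[ p ]
  (x ≡ 2 ^ n * (2 * p + 5) ∸ 1 × y ≡ 2 ^ m * (2 * p + 5) ∸ 1)

InPb : Pos → Set
InPb empty = ⊥
InPb (bar x y s) = ∃[ n ] ∃[ m ] (x ≡ 2 ^ n * 3 ∸ 1 × y ≡ 2 ^ m * 4 ∸ 1)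

InPc : Pos → Set
InPc empty = ⊥
InPc (bar x y s) = ∃[ n ] ∃[ m ] (x ≡ 2 ^ n * 4 ∸ 1 × y ≡ 2 ^ m * 3 ∸ 1)

data InP : Pos → Set where
  inPa : ∀ {q} → InPa q → InP q
  inPb : ∀ {q} → InPb q → InP q
  inPc : ∀ {q} → InPc q → InP q
  in12 : ∀ {s} → InP (bar 1 2 s)
  in21 : ∀ {s} → InP (bar 2 1 s)
  inEmpty : InP empty

data InL : Pos → Set where
  colL : ∀ n → InL (bar (2 * n + 5) 1 false)
  rowL : ∀ n → InL (bar 1 (2 * n + 5) false)
  oneL : InL (bar 1 1 false)

data InR : Pos → Set where
  colR : ∀ n → InR (bar (2 * n + 5) 1 true)
  rowR : ∀ n → InR (bar 1 (2 * n + 5) true)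
  oneR : InR (bar 1 1 true)

InN : Pos → Set
InN empty = ⊥
InN (bar x y s) = 1 ≤ x × 1 ≤ y × ¬ InP (bar x y s) × ¬ InL (bar x y s) × ¬ InR (bar x y s)

{-# OPTIONS --safe #-}
-- A colour fills ⌊A/2⌋ or ⌈A/2⌉ cells of a checkerboard rectangle of area A, so either player
-- may eat a piece of smaller area than the piece kept, and on an exact halving one of the two
-- halves.  Hence from a bar with y ≤ x a player can cut x down to any x′ with x′ < x ≤ 2x′.
-- Write y + 1 = 2^e·o with o odd and take t = o if o ≥ 5, t = 3 if o = 1, t = 4 if o = 3.
-- Some 2^j·t lies in ((x + 1)/2, x + 1], and x′ = 2^j·t − 1 puts (x′, y) in P_a, P_b or P_c
-- respectively; x′ = x would mean the bar was already in P, and t ≤ x + 1 fails only for the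
-- 2 × 2 bar, which is cut to 1 × 2.  A column of even length at least 6 loses an end block,
-- leaving the odd column of the mover's colour in L or R; transposition covers y > x.
module Submission where

open import Defs
open import Data.Product using (Σ; _×_; _,_; proj₁; proj₂)
open import Data.Sum using (_⊎_; inj₁; inj₂; [_,_])
import Data.Sum as Sum
open import Data.Nat using (ℕ; zero; suc; _+_; _*_; _∸_; _^_; _≤_; _<_; z≤n; s≤s; z<s; _≤?_; _<?_; ⌊_/2⌋; ⌈_/2⌉; >-nonZero)
open import Data.Nat.Properties hiding (_≟_)
open import Data.Nat.Induction using (<-rec)
open import Data.Nat.Tactic.RingSolver using (solve-∀)
open import Data.Bool using (Bool; true; false; not; if_then_else_; _≟_)
open import Data.Bool.Properties using (not-involutive; ¬-not)
open import Data.List using (List; _∷_; _++_; upTo; applyUpTo; map; concatMap; filter; length)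
open import Data.List.Properties using (map-upTo; map-∘; map-cong; filter-++; length-++)
open import Data.Empty using (⊥-elim)
open import Function using (_∘_; _∘′_)
open import Relation.Nullary using (¬_; yes; no; does)
open import Relation.Unary using (Decidable)
open import Relation.Binary.PropositionalEquality using (_≡_; refl; sym; trans; cong; cong₂; subst; subst₂; module ≡-Reasoning)

half : Bool → ℕ → ℕ
half true  n = ⌈ n /2⌉
half false n = ⌊ n /2⌋

half-zero : ∀ b → half b 0 ≡ 0
half-zero true  = refl
half-zero false = refl

half-suc : ∀ b n → (if b then 1 else 0) + half (not b) n ≡ half b (suc n)
half-suc true  n = refl
half-suc false n = refl

half-+2 : ∀ b n → half b (2 + n) ≡ suc (half b n)
half-+2 true  n = refl
half-+2 false n = refl

half-+-double : ∀ b m n → half b (m + (m + n)) ≡ m + half b n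
half-+-double b zero    n = refl
half-+-double b (suc m) n = begin
  half b (suc (m + suc (m + n)))  ≡⟨ cong (half b ∘ suc) (+-suc m (m + n)) ⟩
  half b (2 + (m + (m + n)))      ≡⟨ half-+2 b (m + (m + n)) ⟩
  suc (half b (m + (m + n)))      ≡⟨ cong suc (half-+-double b m n) ⟩
  suc (m + half b n)              ∎
  where open ≡-Reasoning

half-+-half-not : ∀ b n → half b n + half (not b) n ≡ n
half-+-half-not true  n = trans (+-comm ⌈ n /2⌉ ⌊ n /2⌋) (⌊n/2⌋+⌈n/2⌉≡n n)
half-+-half-not false n = ⌊n/2⌋+⌈n/2⌉≡n n

half≤⌈n/2⌉ : ∀ b n → half b n ≤ ⌈ n /2⌉
half≤⌈n/2⌉ true  n = ≤-refl
half≤⌈n/2⌉ false n = ⌊n/2⌋≤⌈n/2⌉ n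

⌊n/2⌋≤half : ∀ b n → ⌊ n /2⌋ ≤ half b n
⌊n/2⌋≤half true  n = ⌊n/2⌋≤⌈n/2⌉ n
⌊n/2⌋≤half false n = ≤-refl

half-mono-< : ∀ b b′ {m n} → m < n → half b m ≤ half b′ n
half-mono-< b b′ {m} {n} m<n = begin
  half b m   ≤⟨ half≤⌈n/2⌉ b m ⟩
  ⌈ m /2⌉    ≤⟨ ⌊n/2⌋-mono m<n ⟩
  ⌊ n /2⌋    ≤⟨ ⌊n/2⌋≤half b′ n ⟩
  half b′ n  ∎
  where open ≤-Reasoning

checkerRows : Bool → ℕ → ℕ → ℕ
checkerRows b zero    w = 0
checkerRows b (suc h) w = half b w + checkerRows (not b) h w

checkerRows≡half : ∀ b h w → checkerRows b h w ≡ half b (h * w)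
checkerRows≡half b zero          w = sym (half-zero b)
checkerRows≡half b (suc zero)    w = trans (+-identityʳ (half b w)) (cong (half b) (sym (+-identityʳ w)))
checkerRows≡half b (suc (suc h)) w = begin
  half b w + (half (not b) w + checkerRows (not (not b)) h w)
    ≡⟨ sym (+-assoc (half b w) (half (not b) w) _) ⟩
  (half b w + half (not b) w) + checkerRows (not (not b)) h w
    ≡⟨ cong₂ _+_ (half-+-half-not b w) (cong (λ b′ → checkerRows b′ h w) (not-involutive b)) ⟩
  w + checkerRows b h w
    ≡⟨ cong (w +_) (checkerRows≡half b h w) ⟩
  w + half b (h * w)
    ≡⟨ sym (half-+-double b w (h * w)) ⟩
  half b (w + (w + h * w))
    ∎
  where open ≡-Reasoning

entry-1 : ∀ s n → entry s 1 n ≡ not (entry s 0 n)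
entry-1 s zero          = refl
entry-1 s (suc zero)    = sym (not-involutive s)
entry-1 s (suc (suc n)) = entry-1 s n

entry-sucˡ : ∀ s i j → entry s (suc i) j ≡ not (entry s i j)
entry-sucˡ s i j = entry-1 s (i + j)

entry-comm : ∀ s i j → entry s i j ≡ entry s j i
entry-comm s i j = cong (entry s 0) (+-comm i j)

entry-sucʳ : ∀ s i j → entry s i (suc j) ≡ not (entry s i j)
entry-sucʳ s i j = begin
  entry s i (suc j)    ≡⟨ entry-comm s i (suc j) ⟩
  entry s (suc j) i    ≡⟨ entry-sucˡ s j i ⟩
  not (entry s j i)    ≡⟨ cong not (entry-comm s j i) ⟩
  not (entry s i j)    ∎
  where open ≡-Reasoning

does-not-≟ : ∀ t c → does (not t ≟ c) ≡ not (does (t ≟ c))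
does-not-≟ true  true  = refl
does-not-≟ true  false = refl
does-not-≟ false true  = refl
does-not-≟ false false = refl

length-filter-∷ : ∀ {A : Set} {P : A → Set} (P? : Decidable P) x xs →
  length (filter P? (x ∷ xs)) ≡ (if does (P? x) then 1 else 0) + length (filter P? xs)
length-filter-∷ P? x xs with does (P? x)
... | true  = refl
... | false = refl

interval : ℕ → ℕ → List ℕ
interval a n = map (a +_) (upTo n)

interval-suc : ∀ a n → interval a (suc n) ≡ a ∷ interval (suc a) n
interval-suc a n = cong₂ _∷_ (+-identityʳ a) (begin
  map (a +_) (applyUpTo suc n)   ≡⟨ cong (map (a +_)) (sym (map-upTo suc n)) ⟩
  map (a +_) (map suc (upTo n))  ≡⟨ sym (map-∘ (upTo n)) ⟩
  map ((a +_) ∘ suc) (upTo n)    ≡⟨ map-cong (+-suc a) (upTo n) ⟩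
  map (suc a +_) (upTo n)        ∎)
  where open ≡-Reasoning

module _ (c s : Colour) where
  private
    Cell? : Decidable (λ (ij : ℕ × ℕ) → entry s (proj₁ ij) (proj₂ ij) ≡ c)
    Cell? ij = entry s (proj₁ ij) (proj₂ ij) ≟ c

    matches : ℕ → ℕ → Bool
    matches i j = does (entry s i j ≟ c)

    row : ℕ → ℕ → ℕ → List (ℕ × ℕ)
    row i j w = map (i ,_) (interval j w)

  row-count : ∀ i j w → length (filter Cell? (row i j w)) ≡ half (matches i j) w
  row-count i j zero    = sym (half-zero (matches i j))
  row-count i j (suc w) = begin
    length (filter Cell? (row i j (suc w)))
      ≡⟨ cong (length ∘ filter Cell? ∘ map (i ,_)) (interval-suc j w) ⟩
    length (filter Cell? ((i , j) ∷ row i (suc j) w))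
      ≡⟨ length-filter-∷ Cell? (i , j) (row i (suc j) w) ⟩
    (if b then 1 else 0) + length (filter Cell? (row i (suc j) w))
      ≡⟨ cong ((if b then 1 else 0) +_) (row-count i (suc j) w) ⟩
    (if b then 1 else 0) + half (matches i (suc j)) w
      ≡⟨ cong (λ b′ → (if b then 1 else 0) + half b′ w) flip ⟩
    (if b then 1 else 0) + half (not b) w
      ≡⟨ half-suc b w ⟩
    half b (suc w)
      ∎
    where
    open ≡-Reasoning
    b = matches i j
    flip : matches i (suc j) ≡ not b
    flip = trans (cong (λ t → does (t ≟ c)) (entry-sucʳ s i j)) (does-not-≟ (entry s i j) c)

  rows-count : ∀ i j h w →
    length (filter Cell? (concatMap (λ i′ → row i′ j w) (interval i h)))
      ≡ checkerRows (matches i j) h w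
  rows-count i j zero    w = refl
  rows-count i j (suc h) w = begin
    length (filter Cell? (concatMap (λ i′ → row i′ j w) (interval i (suc h))))
      ≡⟨ cong (length ∘ filter Cell? ∘ concatMap (λ i′ → row i′ j w)) (interval-suc i h) ⟩
    length (filter Cell? (row i j w ++ rest))
      ≡⟨ cong length (filter-++ Cell? (row i j w) rest) ⟩
    length (filter Cell? (row i j w) ++ filter Cell? rest)
      ≡⟨ length-++ (filter Cell? (row i j w)) ⟩
    length (filter Cell? (row i j w)) + length (filter Cell? rest)
      ≡⟨ cong₂ _+_ (row-count i j w) (rows-count (suc i) j h w) ⟩
    half b w + checkerRows (matches (suc i) j) h w
      ≡⟨ cong (λ b′ → half b w + checkerRows b′ h w) flip ⟩
    half b w + checkerRows (not b) h w
      ∎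
    where
    open ≡-Reasoning
    b = matches i j
    rest = concatMap (λ i′ → row i′ j w) (interval (suc i) h)
    flip : matches (suc i) j ≡ not b
    flip = trans (cong (λ t → does (t ≟ c)) (entry-sucˡ s i j)) (does-not-≟ (entry s i j) c)

count≡half : ∀ c s r0 r1 c0 c1 →
  count c s r0 r1 c0 c1 ≡ half (does (entry s r0 c0 ≟ c)) ((r1 ∸ r0) * (c1 ∸ c0))
count≡half c s r0 r1 c0 c1 =
  trans (rows-count c s r0 c0 (r1 ∸ r0) (c1 ∸ c0)) (checkerRows≡half _ (r1 ∸ r0) (c1 ∸ c0))

count-mono-area : ∀ c s s′ r0 r1 c0 c1 r0′ r1′ c0′ c1′ →
  (r1 ∸ r0) * (c1 ∸ c0) < (r1′ ∸ r0′) * (c1′ ∸ c0′) →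
  count c s r0 r1 c0 c1 ≤ count c s′ r0′ r1′ c0′ c1′
count-mono-area c s s′ r0 r1 c0 c1 r0′ r1′ c0′ c1′ lt =
  subst₂ _≤_ (sym (count≡half c s r0 r1 c0 c1)) (sym (count≡half c s′ r0′ r1′ c0′ c1′))
    (half-mono-< (does (entry s r0 c0 ≟ c)) (does (entry s′ r0′ c0′ ≟ c)) lt)

count-transpose : ∀ c s r0 r1 c0 c1 → count c s r0 r1 c0 c1 ≡ count c s c0 c1 r0 r1
count-transpose c s r0 r1 c0 c1 = begin
  count c s r0 r1 c0 c1
    ≡⟨ count≡half c s r0 r1 c0 c1 ⟩
  half (does (entry s r0 c0 ≟ c)) ((r1 ∸ r0) * (c1 ∸ c0))
    ≡⟨ cong₂ half (cong (λ t → does (t ≟ c)) (entry-comm s r0 c0)) (*-comm (r1 ∸ r0) (c1 ∸ c0)) ⟩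
  half (does (entry s c0 r0 ≟ c)) ((c1 ∸ c0) * (r1 ∸ r0))
    ≡⟨ sym (count≡half c s c0 c1 r0 r1) ⟩
  count c s c0 c1 r0 r1
    ∎
  where open ≡-Reasoning

count-transpose-≤ : ∀ c s s′ r0 r1 c0 c1 r0′ r1′ c0′ c1′ →
  count c s r0 r1 c0 c1 ≤ count c s′ r0′ r1′ c0′ c1′ →
  count c s c0 c1 r0 r1 ≤ count c s′ c0′ c1′ r0′ r1′
count-transpose-≤ c s s′ r0 r1 c0 c1 r0′ r1′ c0′ c1′ =
  subst₂ _≤_ (count-transpose c s r0 r1 c0 c1) (count-transpose c s′ r0′ r1′ c0′ c1′)

KeepsHalf : ℕ → ℕ → Set
KeepsHalf n k = 1 ≤ k × k < n × n ≤ k + k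

transpose : Pos → Pos
transpose empty       = empty
transpose (bar x y s) = bar y x s

module _ (pl : Player) where
  private
    rc = restricted pl

  keepTop : ∀ {x y s k} → 1 ≤ y → 1 ≤ k → k < x → x < k + k → Move pl (bar x y s) (bar k y s)
  keepTop {x} {y} {s} {k} 1≤y 1≤k k<x x<2k =
    hEatBottom 1≤k k<x (count-mono-area rc s s k x 0 y 0 k 0 y area<)
    where
    area< : (x ∸ k) * y < k * y
    area< = *-monoˡ-< y {{>-nonZero 1≤y}} (m<n+o⇒m∸n<o x k {{>-nonZero 1≤k}} x<2k)

  keepBottom : ∀ {x y s k} → 1 ≤ y → 1 ≤ k → k + k < x →
               Move pl (bar x y s) (bar (x ∸ k) y (entry s k 0))
  keepBottom {x} {y} {s} {k} 1≤y 1≤k 2k<x =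
    hEatTop 1≤k k<x (count-mono-area rc s s 0 k 0 y k x 0 y area<)
    where
    k<x : k < x
    k<x = <-≤-trans (m<m+n k 1≤k) (<⇒≤ 2k<x)
    area< : k * y < (x ∸ k) * y
    area< = *-monoˡ-< y {{>-nonZero 1≤y}} (m+n≤o⇒m≤o∸n (suc k) 2k<x)

  cutRows : ∀ {x y s k} → KeepsHalf x k → 1 ≤ y → Σ Colour λ t → Move pl (bar x y s) (bar k y t)
  cutRows {x} {y} {s} {k} (1≤k , k<x , x≤2k) 1≤y with m≤n⇒m<n∨m≡n x≤2k
  ... | inj₁ x<2k = s , keepTop 1≤y 1≤k k<x x<2k
  ... | inj₂ refl with ≤-total (count rc s k (k + k) 0 y) (count rc s 0 k 0 y)
  ...   | inj₁ bottom≤top = s , hEatBottom 1≤k k<x bottom≤top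
  ...   | inj₂ top≤bottom = entry s k 0 ,
          subst (λ h → Move pl (bar (k + k) y s) (bar h y (entry s k 0))) (m+n∸m≡n k k)
            (hEatTop 1≤k k<x top≤bottom)

  trimRow : ∀ {x y s} → 2 ≤ x → 1 ≤ y → ∀ t → Move pl (bar (suc x) y s) (bar x y t)
  trimRow {x} {y} {s} 2≤x 1≤y t with t ≟ s
  ... | yes refl = keepTop 1≤y (≤-trans (s≤s z≤n) 2≤x) (n<1+n x) (+-monoˡ-≤ x 2≤x)
  ... | no t≢s   =
    subst (λ u → Move pl _ (bar x y u)) (sym (¬-not t≢s)) (keepBottom 1≤y ≤-refl (s≤s 2≤x))

  Move-transpose : ∀ {q r} → Move pl q r → Move pl (transpose q) (transpose r)
  Move-transpose (hEatTop {x} {y} {s} {k} 1≤k k<x le) =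
    subst (λ t → Move pl _ (bar _ _ t)) (entry-comm s 0 k)
      (vEatLeft 1≤k k<x (count-transpose-≤ rc s s 0 k 0 y k x 0 y le))
  Move-transpose (hEatBottom {x} {y} {s} {k} 1≤k k<x le) =
    vEatRight 1≤k k<x (count-transpose-≤ rc s s k x 0 y 0 k 0 y le)
  Move-transpose (vEatLeft {x} {y} {s} {k} 1≤k k<y le) =
    subst (λ t → Move pl _ (bar _ _ t)) (entry-comm s k 0)
      (hEatTop 1≤k k<y (count-transpose-≤ rc s s 0 x 0 k 0 x k y le))
  Move-transpose (vEatRight {x} {y} {s} {k} 1≤k k<y le) =
    hEatBottom 1≤k k<y (count-transpose-≤ rc s s 0 x k y 0 x 0 k le)
  Move-transpose eatSingle = eatSingle

even-or-odd : ∀ n → Σ ℕ λ k → n ≡ 2 * k ⊎ n ≡ 1 + 2 * k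
even-or-odd zero = 0 , inj₁ refl
even-or-odd (suc n) with even-or-odd n
... | k , inj₁ n≡2k   = k , inj₂ (cong suc n≡2k)
... | k , inj₂ n≡2k+1 = suc k , inj₁ (trans (cong suc n≡2k+1) (sym (*-suc 2 k)))

odd-part : ∀ n → Σ ℕ λ e → Σ ℕ λ q → suc n ≡ 2 ^ e * (2 * q + 1)
odd-part = <-rec _ step
  where
  odd-form : ∀ k → suc (2 * k) ≡ 2 ^ 0 * (2 * k + 1)
  odd-form = solve-∀
  step : ∀ n → (∀ {m} → m < n → Σ ℕ λ e → Σ ℕ λ q → suc m ≡ 2 ^ e * (2 * q + 1)) →
         Σ ℕ λ e → Σ ℕ λ q → suc n ≡ 2 ^ e * (2 * q + 1)
  step n rec with even-or-odd n
  ... | k , inj₁ n≡2k = 0 , k , trans (cong suc n≡2k) (odd-form k)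
  ... | k , inj₂ n≡2k+1 with rec (≤-trans (s≤s (m≤m+n k (k + 0))) (≤-reflexive (sym n≡2k+1)))
  ...   | e , q , k+1≡ = suc e , q , (begin
    suc n                        ≡⟨ cong suc n≡2k+1 ⟩
    2 + 2 * k                    ≡⟨ sym (*-suc 2 k) ⟩
    2 * suc k                    ≡⟨ cong (2 *_) k+1≡ ⟩
    2 * (2 ^ e * (2 * q + 1))    ≡⟨ sym (*-assoc 2 (2 ^ e) (2 * q + 1)) ⟩
    2 ^ suc e * (2 * q + 1)      ∎)
    where open ≡-Reasoning

parity-from-5 : ∀ {x} → 5 ≤ x → Σ ℕ λ k → x ≡ 2 * k + 5 ⊎ x ≡ suc (2 * k + 5)
parity-from-5 {x} 5≤x with even-or-odd (x ∸ 5)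
... | k , inj₁ eq = k , inj₁ (trans (sym (m∸n+n≡m 5≤x)) (cong (_+ 5) eq))
... | k , inj₂ eq = k , inj₂ (trans (sym (m∸n+n≡m 5≤x)) (cong (_+ 5) eq))

n<2^n : ∀ n → n < 2 ^ n
n<2^n zero    = z<s
n<2^n (suc n) = +-mono-≤-< (m^n>0 2 n) (subst (n <_) (sym (+-identityʳ (2 ^ n))) (n<2^n n))

m≤2^n*m : ∀ n m → m ≤ 2 ^ n * m
m≤2^n*m n m = m≤n*m m (2 ^ n) {{m^n≢0 2 n}}

2^[1+n]*m≡2^n*m+2^n*m : ∀ n m → 2 ^ suc n * m ≡ 2 ^ n * m + 2 ^ n * m
2^[1+n]*m≡2^n*m+2^n*m n m =
  trans (*-assoc 2 (2 ^ n) m) (cong (2 ^ n * m +_) (+-identityʳ (2 ^ n * m)))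

dyadic-bracket : ∀ {o b} → 1 ≤ o → o ≤ b → Σ ℕ λ j → 2 ^ j * o ≤ b × b < 2 ^ j * o + 2 ^ j * o
dyadic-bracket {o} {b} 1≤o o≤b = search b (<-≤-trans (n<2^n b) (m≤m*n (2 ^ b) o {{>-nonZero 1≤o}}))
  where
  search : ∀ f → b < 2 ^ f * o → Σ ℕ λ j → 2 ^ j * o ≤ b × b < 2 ^ j * o + 2 ^ j * o
  search zero    b<o = ⊥-elim (<⇒≱ (subst (b <_) (*-identityˡ o) b<o) o≤b)
  search (suc f) b<2^[1+f]o with b <? 2 ^ f * o
  ... | yes b<2^fo = search f b<2^fo
  ... | no  b≮2^fo = f , ≮⇒≥ b≮2^fo , subst (b <_) (2^[1+n]*m≡2^n*m+2^n*m f o) b<2^[1+f]o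

halve-below : ∀ {m x} → 2 ≤ m → m < suc x → suc x < m + m →
              Σ ℕ λ x′ → KeepsHalf x x′ × suc x′ ≡ m
halve-below {suc m} {x} (s≤s 1≤m) (s≤s m<x) (s≤s x<m+1+m) =
  m , (1≤m , m<x , ≤-pred (subst (x <_) (+-suc m m) x<m+1+m)) , refl

halve-toward : ∀ {o x} → 2 ≤ o → o ≤ suc x →
  (Σ ℕ λ j → suc x ≡ 2 ^ j * o) ⊎
  (Σ ℕ λ x′ → KeepsHalf x x′ × Σ ℕ λ j → suc x′ ≡ 2 ^ j * o)
halve-toward {o} 2≤o o≤x+1 with dyadic-bracket (≤-trans (s≤s z≤n) 2≤o) o≤x+1
... | j , lower , upper with m≤n⇒m<n∨m≡n lower
...   | inj₂ eq = inj₁ (j , sym eq)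
...   | inj₁ lt with halve-below (≤-trans 2≤o (m≤2^n*m j o)) lt upper
...     | x′ , half , eq = inj₂ (x′ , half , j , eq)

cut-toward-P : ∀ {x y s} o → 2 ≤ o → o ≤ suc x → ¬ InP (bar x y s) →
  (∀ {x′} j → suc x′ ≡ 2 ^ j * o → ∀ t → InP (bar x′ y t)) →
  Σ ℕ λ x′ → KeepsHalf x x′ × (∀ t → InP (bar x′ y t))
cut-toward-P {s = s} o 2≤o o≤x+1 ¬P inP with halve-toward 2≤o o≤x+1
... | inj₁ (j , x+1≡)          = ⊥-elim (¬P (inP j x+1≡ s))
... | inj₂ (x′ , half , j , eq) = x′ , half , inP j eq

power-of-2-≥3 : ∀ e → 3 ≤ 2 ^ e * 1 → Σ ℕ λ e′ → 2 ^ e * 1 ≡ 2 ^ e′ * 4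
power-of-2-≥3 zero          (s≤s ())
power-of-2-≥3 (suc zero)    (s≤s (s≤s ()))
power-of-2-≥3 (suc (suc e)) _ = e , times4 (2 ^ e)
  where
  times4 : ∀ a → 2 * (2 * a) * 1 ≡ a * 4
  times4 = solve-∀

2[2+p]+1≡2p+5 : ∀ p → 2 * suc (suc p) + 1 ≡ 2 * p + 5
2[2+p]+1≡2p+5 = solve-∀

cut-to-P : ∀ {x y s} → 2 ≤ y → y ≤ x → ¬ InP (bar x y s) →
  Σ ℕ λ x′ → KeepsHalf x x′ × (∀ t → InP (bar x′ y t))
cut-to-P {x} {y} 2≤y y≤x ¬P with odd-part y
... | e , 0 , y+1≡2^e with power-of-2-≥3 e (subst (3 ≤_) y+1≡2^e (s≤s 2≤y))
...   | e′ , 2^e≡2^e′*4 = cut-toward-P 3 (s≤s (s≤s z≤n)) (s≤s (≤-trans 2≤y y≤x)) ¬P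
        λ j x′+1≡ t → inPb (j , e′ , cong (_∸ 1) x′+1≡ , cong (_∸ 1) (trans y+1≡2^e 2^e≡2^e′*4))
cut-to-P {x} {y} 2≤y y≤x ¬P | e , 1 , y+1≡3*2^e with 4 ≤? suc x
... | yes 4≤x+1 = cut-toward-P 4 (s≤s (s≤s z≤n)) 4≤x+1 ¬P
      λ j x′+1≡ t → inPc (j , e , cong (_∸ 1) x′+1≡ , cong (_∸ 1) y+1≡3*2^e)
... | no  4≰x+1 = 1 , (≤-refl , ≤-trans 2≤y y≤x , x≤2) ,
                  λ t → subst (λ z → InP (bar 1 z t)) (sym y≡2) in12
  where
  x≤2 : x ≤ 2
  x≤2 = ≤-pred (≤-pred (≰⇒> 4≰x+1))
  y≡2 : y ≡ 2
  y≡2 = ≤-antisym (≤-trans y≤x x≤2) 2≤y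
cut-to-P {x} {y} 2≤y y≤x ¬P | e , suc (suc p) , y+1≡ =
  cut-toward-P (2 * p + 5) (≤-trans (s≤s (s≤s z≤n)) (m≤n+m 5 (2 * p))) o≤x+1 ¬P
    λ j x′+1≡ t → inPa (j , e , p , cong (_∸ 1) x′+1≡ , cong (_∸ 1) y+1≡2^e*o)
  where
  y+1≡2^e*o : suc y ≡ 2 ^ e * (2 * p + 5)
  y+1≡2^e*o = trans y+1≡ (cong (2 ^ e *_) (2[2+p]+1≡2p+5 p))
  o≤x+1 : 2 * p + 5 ≤ suc x
  o≤x+1 = ≤-trans (m≤2^n*m e (2 * p + 5)) (≤-trans (≤-reflexive (sym y+1≡2^e*o)) (s≤s y≤x))

InP-transpose : ∀ {q} → InP q → InP (transpose q)
InP-transpose {bar _ _ _} (inPa (n , m , p , ex , ey)) = inPa (m , n , p , ey , ex)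
InP-transpose {bar _ _ _} (inPb (n , m , ex , ey))     = inPc (m , n , ey , ex)
InP-transpose {bar _ _ _} (inPc (n , m , ex , ey))     = inPb (m , n , ey , ex)
InP-transpose in12    = in21
InP-transpose in21    = in12
InP-transpose inEmpty = inEmpty

InL-transpose : ∀ {q} → InL q → InL (transpose q)
InL-transpose (colL n) = rowL n
InL-transpose (rowL n) = colL n
InL-transpose oneL     = oneL

InR-transpose : ∀ {q} → InR q → InR (transpose q)
InR-transpose (colR n) = rowR n
InR-transpose (rowR n) = colR n
InR-transpose oneR     = oneR

InN-transpose : ∀ {x y s} → InN (bar x y s) → InN (bar y x s)
InN-transpose (1≤x , 1≤y , ¬P , ¬L , ¬R) =
  1≤y , 1≤x , ¬P ∘′ InP-transpose , ¬L ∘′ InL-transpose , ¬R ∘′ InR-transpose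

WonBy : Player → Pos → Set
WonBy Left  = InL
WonBy Right = InR

WonBy-transpose : ∀ pl {q} → WonBy pl q → WonBy pl (transpose q)
WonBy-transpose Left  = InL-transpose
WonBy-transpose Right = InR-transpose

WonBy-column : ∀ pl n → WonBy pl (bar (2 * n + 5) 1 (not (restricted pl)))
WonBy-column Left  = colL
WonBy-column Right = colR

column-L⊎R : ∀ n s → InL (bar (2 * n + 5) 1 s) ⊎ InR (bar (2 * n + 5) 1 s)
column-L⊎R n false = inj₁ (colL n)
column-L⊎R n true  = inj₂ (colR n)

module _ (pl : Player) where

  TargetMove : Pos → Set
  TargetMove q = Σ Pos λ r → Move pl q r × (InP r ⊎ WonBy pl r)

  pairColumn : ∀ {x s} → KeepsHalf x 2 → TargetMove (bar x 1 s)
  pairColumn half with cutRows pl half ≤-refl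
  ... | t , mv = bar 2 1 t , mv , inj₁ in21

  longColumn : ∀ {x s} → 5 ≤ x → InN (bar x 1 s) → TargetMove (bar x 1 s)
  longColumn {x} {s} 5≤x (_ , _ , _ , ¬L , ¬R) with parity-from-5 5≤x
  ... | k , inj₁ refl = ⊥-elim ([ ¬L , ¬R ] (column-L⊎R k s))
  ... | k , inj₂ refl = bar (2 * k + 5) 1 c , trimRow pl 2≤2k+5 ≤-refl c , inj₂ (WonBy-column pl k)
    where
    c = not (restricted pl)
    2≤2k+5 : 2 ≤ 2 * k + 5
    2≤2k+5 = ≤-trans (s≤s (s≤s z≤n)) (m≤n+m 5 (2 * k))

  columnMove : ∀ {x s} → InN (bar x 1 s) → TargetMove (bar x 1 s)
  columnMove {0} (() , _)
  columnMove {1} {false} (_ , _ , _ , ¬L , _) = ⊥-elim (¬L oneL)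
  columnMove {1} {true}  (_ , _ , _ , _ , ¬R) = ⊥-elim (¬R oneR)
  columnMove {2} (_ , _ , ¬P , _)             = ⊥-elim (¬P in21)
  columnMove {3} _ = pairColumn (s≤s z≤n , ≤-refl , n≤1+n 3)
  columnMove {4} _ = pairColumn (s≤s z≤n , n≤1+n 3 , ≤-refl)
  columnMove {suc (suc (suc (suc (suc _))))} n = longColumn (s≤s (s≤s (s≤s (s≤s (s≤s z≤n))))) n

  tallMove : ∀ {x y s} → y ≤ x → InN (bar x y s) → TargetMove (bar x y s)
  tallMove {y = 0} _ (_ , () , _)
  tallMove {y = 1} _ n = columnMove n
  tallMove {x} {suc (suc y)} 2+y≤x (_ , 1≤y , ¬P , _) with cut-to-P (s≤s (s≤s z≤n)) 2+y≤x ¬P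
  ... | x′ , half , inP with cutRows pl half 1≤y
  ...   | t , mv = bar x′ (suc (suc y)) t , mv , inj₁ (inP t)

  strategy : ∀ q → InN q → TargetMove q
  strategy (bar x y s) n with ≤-total y x
  ... | inj₁ y≤x = tallMove y≤x n
  ... | inj₂ x≤y with tallMove x≤y (InN-transpose n)
  ...   | r , mv , won =
    transpose r , Move-transpose pl mv , Sum.map InP-transpose (WonBy-transpose pl) won

lemma4p16 : ((q : Pos) → InN q → Σ Pos (λ r → Move Left q r × (InP r ⊎ InL r)))
    × ((q : Pos) → InN q → Σ Pos (λ r → Move Right q r × (InP r ⊎ InR r)))
lemma4p16 = strategy Left , strategy Right
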